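{- Let $M$ be a symmetric $n\times n$ matrix all of whose entries are $0$ or $1$. The following two conditions are equivalent. (1) One can apply the same permutation to the rows and to the columns of $M$ (i.e. choose a permutation $f$ of $\{1,\dots,n\}$ and send the $(i,j)$ entry to position $(f(i),f(j))$), and then change some entries on the main diagonal, so that the resulting matrix has the following form: for some $k$ with $0\le k\le n$, the upper-left $k\times k$ submatrix consists entirely of ones, and every entry outside this submatrix is zero. (2) There is no permutation applied simultaneously to the rows and columns of $M$ after which the upper-left corner of the resulting matrix is a submatrix of the form $$P=\begin{pmatrix} * & 1 & 1\\ 1 & * & 0\\ 1 & 0 & *\end{pmatrix}\quad\text{or}\quad Q=\begin{pmatrix} * & 1 & 0 & 0\\ 1 & * & 0 & 0\\ 0 & 0 & * & 1\\ 0 & 0 & 1 & *\end{pmatrix},$$ where each $*$ denotes an arbitrary entry (the $*$'s need not be equal). -}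

module Defs where

open import Data.Bool using (Bool; true; false; _∧_)
open import Data.Nat using (ℕ; zero; suc; _≤_; _<_; _<ᵇ_)
open import Data.Fin using (Fin; toℕ)
open import Data.Fin.Permutation using (Permutation′; _⟨$⟩ˡ_)
open import Data.Product using (Σ; _×_; ∃)
open import Data.Sum using (_⊎_)
open import Relation.Nullary using (¬_)
open import Relation.Binary.PropositionalEquality using (_≡_; _≢_)

-- An n×n 0/1 matrix (false = 0, true = 1).
Matrix : ℕ → Set
Matrix n = Fin n → Fin n → Bool

Symmetric : ∀ {n} → Matrix n → Set
Symmetric M = ∀ i j → M i j ≡ M j i

-- Simultaneous row/column permutation by f: entry (i,j) goes to (f i, f j),
-- i.e. the new matrix at (a,b) is M (f⁻¹ a) (f⁻¹ b).
permute : ∀ {n} → Permutation′ n → Matrix n → Matrix n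
permute f M a b = M (f ⟨$⟩ˡ a) (f ⟨$⟩ˡ b)

AgreeOffDiag : ∀ {n} → Matrix n → Matrix n → Set
AgreeOffDiag M N = ∀ a b → a ≢ b → M a b ≡ N a b

Block : ∀ {n} → ℕ → Matrix n
Block k a b = (toℕ a <ᵇ k) ∧ (toℕ b <ᵇ k)

Condition1 : ∀ {n} → Matrix n → Set
Condition1 {n} M =
  Σ (Permutation′ n) λ f → Σ ℕ λ k → k ≤ n × AgreeOffDiag (permute f M) (Block k)

-- Off-diagonal entries of P (3×3) and Q (4×4), 0-indexed; diagonal entries
-- are arbitrary (*) and never consulted.
patP : ℕ → ℕ → Bool
patP 0 1 = true
patP 0 2 = true
patP 1 0 = true
patP 2 0 = true
patP _ _ = false

patQ : ℕ → ℕ → Bool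
patQ 0 1 = true
patQ 1 0 = true
patQ 2 3 = true
patQ 3 2 = true
patQ _ _ = false

HasCorner : ∀ {n} → ℕ → (ℕ → ℕ → Bool) → Matrix n → Set
HasCorner {n} m pat N =
  m ≤ n × (∀ a b → toℕ a < m → toℕ b < m → a ≢ b → N a b ≡ pat (toℕ a) (toℕ b))

Condition2 : ∀ {n} → Matrix n → Set
Condition2 {n} M =
  ¬ (Σ (Permutation′ n) λ f → HasCorner 3 patP (permute f M) ⊎ HasCorner 4 patQ (permute f M))

-- Read off the diagonal, M is the adjacency matrix of a graph. Condition (1) says that this graph is
-- a clique together with isolated vertices, and since a simultaneous permutation can bring any
-- tuple of distinct vertices to the upper-left corner, condition (2) says that the graph has neither
-- P (a path on three vertices) nor Q (two disjoint edges) as an induced subgraph. A clique plus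
-- isolated vertices obviously contains neither. Conversely, if x ≠ y both have neighbours x′ and y′
-- but are not adjacent, then x, x′, y, y′ span an induced P, or, when no edge joins {x, x′} to
-- {y, y′}, an induced Q; so all vertices with a neighbour are pairwise adjacent.

module Submission where

open import Defs
open import Data.Bool using (Bool; true; false; _∧_)
import Data.Bool.Properties as Bool
open import Data.Nat using (ℕ; zero; suc; _≤_; _<_; _<ᵇ_; z≤n; s≤s)
open import Data.Nat.Properties using (m≤n⇒m≤1+n)
open import Data.Fin using (Fin; zero; suc; toℕ; fromℕ<; inject≤; punchIn; punchOut)
open import Data.Fin.Patterns using (0F; 1F; 2F; 3F)
open import Data.Fin.Properties
  using (_≟_; any?; 0≢1+n; suc-injective; toℕ-injective; toℕ<n; toℕ-fromℕ<; fromℕ<-injective;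
         toℕ-inject≤; inject≤-injective; injective⇒≤; punchIn-punchOut; punchOut-injective)
open import Data.Fin.Permutation
  using (Permutation′; _⟨$⟩ˡ_; _⟨$⟩ʳ_; _∘ₚ_; id; flip; lift₀; transpose; insert; insert-punchIn;
         inverseˡ)
open import Data.Vec using (Vec; []; _∷_; lookup)
open import Data.Vec.Relation.Unary.AllPairs using ([]; _∷_)
open import Data.Vec.Relation.Unary.Unique.Propositional using (Unique)
open import Data.Vec.Relation.Unary.Unique.Propositional.Properties using (lookup-injective)
open import Data.Vec.Relation.Unary.All using ([]; _∷_)
open import Data.Product using (Σ; ∃; _×_; _,_; proj₁; proj₂; map₂)
open import Data.Sum using (inj₁; inj₂; [_,_])
open import Function using (_∘_; _⇔_; mk⇔; Equivalence)
open import Function.Definitions using (Injective)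
open import Relation.Nullary using (¬_; Dec; yes; no; does; ¬?; _×-dec_; contradiction)
open import Relation.Binary.PropositionalEquality
  using (_≡_; _≢_; refl; sym; trans; cong; cong₂; subst; subst₂; module ≡-Reasoning)

<ᵇ-irrefl : ∀ m → (m <ᵇ m) ≡ false
<ᵇ-irrefl zero = refl
<ᵇ-irrefl (suc m) = <ᵇ-irrefl m

<ᵇ-suc : ∀ m → (m <ᵇ suc m) ≡ true
<ᵇ-suc zero = refl
<ᵇ-suc (suc m) = <ᵇ-suc m

<ᵇ-suc-≢ : ∀ {m k} → m ≢ k → (m <ᵇ suc k) ≡ (m <ᵇ k)
<ᵇ-suc-≢ {zero} {zero} m≢k = contradiction refl m≢k
<ᵇ-suc-≢ {zero} {suc k} _ = refl
<ᵇ-suc-≢ {suc m} {zero} _ = refl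
<ᵇ-suc-≢ {suc m} {suc k} m≢k = <ᵇ-suc-≢ (m≢k ∘ cong suc)

⟨$⟩ʳ-injective : ∀ {n} (π : Permutation′ n) → Injective _≡_ _≡_ (π ⟨$⟩ʳ_)
⟨$⟩ʳ-injective π πx≡πy =
  trans (sym (inverseˡ π)) (trans (cong (π ⟨$⟩ˡ_) πx≡πy) (inverseˡ π))

⟨$⟩ˡ-injective : ∀ {n} (π : Permutation′ n) → Injective _≡_ _≡_ (π ⟨$⟩ˡ_)
⟨$⟩ˡ-injective π = ⟨$⟩ʳ-injective (flip π)

sortTrueFirst : ∀ {n} (P : Fin n → Bool) →
                Σ (Permutation′ n) λ π → Σ ℕ λ k → k ≤ n × (∀ a → P (π ⟨$⟩ˡ a) ≡ (toℕ a <ᵇ k))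
sortTrueFirst {zero} P = id , 0 , z≤n , λ ()
sortTrueFirst {suc n} P with sortTrueFirst (P ∘ suc) | P zero in P0
... | π , k , k≤n , sorted | true =
  lift₀ π , suc k , s≤s k≤n , λ { zero → P0 ; (suc a) → sorted a }
... | π , zero , _ , sorted | false =
  lift₀ π , zero , z≤n , λ { zero → P0 ; (suc a) → sorted a }
... | π , suc k , k<n , sorted | false =
  lift₀ π ∘ₚ transpose (suc last) zero , suc k , m≤n⇒m≤1+n k<n , swapped
  where
  -- 0 is false: swap it with the last true element of the sorted tail
  last : Fin n
  last = fromℕ< k<n
  toℕ-last : toℕ last ≡ k
  toℕ-last = toℕ-fromℕ< k<n
  swapped : ∀ a → P (lift₀ π ⟨$⟩ˡ (transpose (suc last) zero ⟨$⟩ˡ a)) ≡ (toℕ a <ᵇ suc k)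
  swapped zero = trans (sorted last) (trans (cong (_<ᵇ suc k) toℕ-last) (<ᵇ-suc k))
  swapped (suc a) with a ≟ last
  ... | yes refl = trans P0 (sym (trans (cong (_<ᵇ k) toℕ-last) (<ᵇ-irrefl k)))
  ... | no a≢last =
    trans (sorted a) (<ᵇ-suc-≢ (a≢last ∘ toℕ-injective ∘ λ a≡k → trans a≡k (sym toℕ-last)))

extendInjection : ∀ {m n} (u : Fin m → Fin n) → Injective _≡_ _≡_ u →
                  Σ (Permutation′ n) λ π → ∀ a (a<m : toℕ a < m) → π ⟨$⟩ʳ a ≡ u (fromℕ< a<m)
extendInjection {zero} u _ = id , λ _ ()
extendInjection {suc m} {zero} u _ with () ← u zero
extendInjection {suc m} {suc n} u u-inj = insert zero (u zero) π , extends′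
  where
  fresh : ∀ i → u zero ≢ u (suc i)
  fresh i = 0≢1+n ∘ u-inj
  u′ : Fin m → Fin n
  u′ i = punchOut (fresh i)
  u′-inj : Injective _≡_ _≡_ u′
  u′-inj {i} {j} = suc-injective ∘ u-inj ∘ punchOut-injective (fresh i) (fresh j)
  π : Permutation′ n
  π = proj₁ (extendInjection u′ u′-inj)
  extends : ∀ a (a<m : toℕ a < m) → π ⟨$⟩ʳ a ≡ u′ (fromℕ< a<m)
  extends = proj₂ (extendInjection u′ u′-inj)
  extends′ : ∀ a (a<m : toℕ a < suc m) → insert zero (u zero) π ⟨$⟩ʳ a ≡ u (fromℕ< a<m)
  extends′ zero _ = refl
  extends′ (suc a) (s≤s a<m) = begin
    insert zero (u zero) π ⟨$⟩ʳ suc a  ≡⟨ insert-punchIn zero (u zero) π a ⟩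
    punchIn (u zero) (π ⟨$⟩ʳ a)        ≡⟨ cong (punchIn (u zero)) (extends a a<m) ⟩
    punchIn (u zero) (u′ (fromℕ< a<m)) ≡⟨ punchIn-punchOut _ ⟩
    u (suc (fromℕ< a<m))               ∎
    where open ≡-Reasoning

CompleteOn : ∀ {n} → (Fin n → Bool) → Matrix n → Set
CompleteOn {n} K M = ∀ (x y : Fin n) → x ≢ y → M x y ≡ K x ∧ K y

record Embeds {n} (m : ℕ) (pat : ℕ → ℕ → Bool) (M : Matrix n) : Set where
  constructor embedding
  field
    vertex    : Fin m → Fin n
    injective : Injective _≡_ _≡_ vertex
    induced   : ∀ i j → i ≢ j → M (vertex i) (vertex j) ≡ pat (toℕ i) (toℕ j)

module InducedSubgraphs {n} (M : Matrix n) where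

  corner⇒embeds : ∀ {m pat} (g : Permutation′ n) → HasCorner m pat (permute g M) → Embeds m pat M
  corner⇒embeds {m} {pat} g (m≤n , corner) = embedding u u-inj entries
    where
    u : Fin m → Fin n
    u i = g ⟨$⟩ˡ inject≤ i m≤n
    u-inj : Injective _≡_ _≡_ u
    u-inj = inject≤-injective m≤n m≤n _ _ ∘ ⟨$⟩ˡ-injective g
    entries : ∀ i j → i ≢ j → M (u i) (u j) ≡ pat (toℕ i) (toℕ j)
    entries i j i≢j =
      trans (corner (inject≤ i m≤n) (inject≤ j m≤n) (bound i) (bound j)
                    (i≢j ∘ inject≤-injective m≤n m≤n i j))
            (cong₂ pat (toℕ-inject≤ i m≤n) (toℕ-inject≤ j m≤n))
      where
      bound : ∀ i → toℕ (inject≤ i m≤n) < m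
      bound i = subst (_< m) (sym (toℕ-inject≤ i m≤n)) (toℕ<n i)

  embeds⇒corner : ∀ {m pat} → Embeds m pat M → ∃ λ g → HasCorner m pat (permute g M)
  embeds⇒corner {m} {pat} (embedding u u-inj entries) with extendInjection u u-inj
  ... | π , extends = flip π , injective⇒≤ u-inj , corner
    where
    corner : ∀ a b → toℕ a < m → toℕ b < m → a ≢ b →
             M (π ⟨$⟩ʳ a) (π ⟨$⟩ʳ b) ≡ pat (toℕ a) (toℕ b)
    corner a b a<m b<m a≢b = begin
      M (π ⟨$⟩ʳ a) (π ⟨$⟩ʳ b)
        ≡⟨ cong₂ M (extends a a<m) (extends b b<m) ⟩
      M (u (fromℕ< a<m)) (u (fromℕ< b<m))
        ≡⟨ entries _ _ (a≢b ∘ toℕ-injective ∘ fromℕ<-injective _ _ a<m b<m) ⟩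
      pat (toℕ (fromℕ< a<m)) (toℕ (fromℕ< b<m))
        ≡⟨ cong₂ pat (toℕ-fromℕ< a<m) (toℕ-fromℕ< b<m) ⟩
      pat (toℕ a) (toℕ b)
        ∎
      where open ≡-Reasoning

  condition2⇔¬embeds : Condition2 M ⇔ (¬ Embeds 3 patP M × ¬ Embeds 4 patQ M)
  condition2⇔¬embeds = mk⇔
    (λ c2 → c2 ∘ map₂ inj₁ ∘ embeds⇒corner , c2 ∘ map₂ inj₂ ∘ embeds⇒corner)
    (λ (noP , noQ) (g , corner) → [ noP ∘ corner⇒embeds g , noQ ∘ corner⇒embeds g ] corner)

  condition1⇒completeOn : Condition1 M → ∃ λ K → CompleteOn K M
  condition1⇒completeOn (f , k , _ , agree) = inBlock , complete
    where
    inBlock : Fin n → Bool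
    inBlock x = toℕ (f ⟨$⟩ʳ x) <ᵇ k
    complete : CompleteOn inBlock M
    complete x y x≢y =
      subst₂ (λ a b → M a b ≡ inBlock x ∧ inBlock y) (inverseˡ f) (inverseˡ f)
        (agree (f ⟨$⟩ʳ x) (f ⟨$⟩ʳ y) (x≢y ∘ ⟨$⟩ʳ-injective f))

  completeOn⇒condition1 : ∀ K → CompleteOn K M → Condition1 M
  completeOn⇒condition1 K complete with sortTrueFirst K
  ... | π , k , k≤n , sorted = π , k , k≤n , λ a b a≢b →
    trans (complete _ _ (a≢b ∘ ⟨$⟩ˡ-injective π)) (cong₂ _∧_ (sorted a) (sorted b))

  condition1⇔completeOn : Condition1 M ⇔ (∃ λ K → CompleteOn K M)
  condition1⇔completeOn =
    mk⇔ condition1⇒completeOn λ (K , complete) → completeOn⇒condition1 K complete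

  completeOn-embedding : ∀ {m pat} K → CompleteOn K M → ((embedding u _ _) : Embeds m pat M) →
                         ∀ i j → i ≢ j → K (u i) ∧ K (u j) ≡ pat (toℕ i) (toℕ j)
  completeOn-embedding K complete (embedding u u-inj entries) i j i≢j =
    trans (sym (complete _ _ (i≢j ∘ u-inj))) (entries i j i≢j)

  completeOn⇒¬embedsP : ∀ K → CompleteOn K M → ¬ Embeds 3 patP M
  completeOn⇒¬embedsP K complete e@(embedding u _ _) = contradiction 12-edge λ ()
    where
    edge : ∀ i j → i ≢ j → K (u i) ∧ K (u j) ≡ patP (toℕ i) (toℕ j)
    edge = completeOn-embedding K complete e
    12-edge : false ≡ true
    12-edge = trans (sym (edge 1F 2F λ ()))
      (cong₂ _∧_ (Bool.∧-conicalʳ (K (u 0F)) _ (edge 0F 1F λ ()))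
                 (Bool.∧-conicalʳ (K (u 0F)) _ (edge 0F 2F λ ())))

  completeOn⇒¬embedsQ : ∀ K → CompleteOn K M → ¬ Embeds 4 patQ M
  completeOn⇒¬embedsQ K complete e@(embedding u _ _) = contradiction 02-edge λ ()
    where
    edge : ∀ i j → i ≢ j → K (u i) ∧ K (u j) ≡ patQ (toℕ i) (toℕ j)
    edge = completeOn-embedding K complete e
    02-edge : false ≡ true
    02-edge = trans (sym (edge 0F 2F λ ()))
      (cong₂ _∧_ (Bool.∧-conicalˡ _ (K (u 1F)) (edge 0F 1F λ ()))
                 (Bool.∧-conicalˡ _ (K (u 3F)) (edge 2F 3F λ ())))

  Adjacent : Fin n → Fin n → Set
  Adjacent x y = x ≢ y × M x y ≡ true

  adjacent? : ∀ x y → Dec (Adjacent x y)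
  adjacent? x y = ¬? (x ≟ y) ×-dec (M x y Bool.≟ true)

  hasNeighbour : Fin n → Bool
  hasNeighbour x = does (any? (adjacent? x))

  module _ (M-sym : Symmetric M) where

    M-sym′ : ∀ {x y b} → M x y ≡ b → M y x ≡ b
    M-sym′ = trans (M-sym _ _)

    inducedPath : ∀ {c x y} → c ≢ x → c ≢ y → x ≢ y →
                  M c x ≡ true → M c y ≡ true → M x y ≡ false → Embeds 3 patP M
    inducedPath {c} {x} {y} c≢x c≢y x≢y cx cy xy =
      embedding (lookup v) (lookup-injective distinct _ _) entries
      where
      v : Vec (Fin n) 3
      v = c ∷ x ∷ y ∷ []
      distinct : Unique v
      distinct = (c≢x ∷ c≢y ∷ []) ∷ (x≢y ∷ []) ∷ [] ∷ []
      entries : ∀ i j → i ≢ j → M (lookup v i) (lookup v j) ≡ patP (toℕ i) (toℕ j)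
      entries 0F 0F 0≢0 = contradiction refl 0≢0
      entries 0F 1F _ = cx
      entries 0F 2F _ = cy
      entries 1F 0F _ = M-sym′ cx
      entries 1F 1F 1≢1 = contradiction refl 1≢1
      entries 1F 2F _ = xy
      entries 2F 0F _ = M-sym′ cy
      entries 2F 1F _ = M-sym′ xy
      entries 2F 2F 2≢2 = contradiction refl 2≢2

    inducedMatching : ∀ {a b c d} → a ≢ b → a ≢ c → a ≢ d → b ≢ c → b ≢ d → c ≢ d →
                      M a b ≡ true → M c d ≡ true →
                      M a c ≡ false → M a d ≡ false → M b c ≡ false → M b d ≡ false →
                      Embeds 4 patQ M
    inducedMatching {a} {b} {c} {d} a≢b a≢c a≢d b≢c b≢d c≢d ab cd ac ad bc bd =
      embedding (lookup v) (lookup-injective distinct _ _) entries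
      where
      v : Vec (Fin n) 4
      v = a ∷ b ∷ c ∷ d ∷ []
      distinct : Unique v
      distinct = (a≢b ∷ a≢c ∷ a≢d ∷ []) ∷ (b≢c ∷ b≢d ∷ []) ∷ (c≢d ∷ []) ∷ [] ∷ []
      entries : ∀ i j → i ≢ j → M (lookup v i) (lookup v j) ≡ patQ (toℕ i) (toℕ j)
      entries 0F 0F 0≢0 = contradiction refl 0≢0
      entries 0F 1F _ = ab
      entries 0F 2F _ = ac
      entries 0F 3F _ = ad
      entries 1F 0F _ = M-sym′ ab
      entries 1F 1F 1≢1 = contradiction refl 1≢1
      entries 1F 2F _ = bc
      entries 1F 3F _ = bd
      entries 2F 0F _ = M-sym′ ac
      entries 2F 1F _ = M-sym′ bc
      entries 2F 2F 2≢2 = contradiction refl 2≢2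
      entries 2F 3F _ = cd
      entries 3F 0F _ = M-sym′ ad
      entries 3F 1F _ = M-sym′ bd
      entries 3F 2F _ = M-sym′ cd
      entries 3F 3F 3≢3 = contradiction refl 3≢3

    module _ (noP : ¬ Embeds 3 patP M) (noQ : ¬ Embeds 4 patQ M) where

      neighbours⇒adjacent : ∀ {x y x′ y′} → x ≢ y → Adjacent x x′ → Adjacent y y′ → M x y ≡ true
      neighbours⇒adjacent {x} {y} {x′} {y′} x≢y (x≢x′ , xx′) (y≢y′ , yy′) with M x y in xy
      ... | true = refl
      ... | false with x′ ≟ y | y′ ≟ x | x′ ≟ y′
      ...   | yes refl | _ | _ = contradiction (trans (sym xx′) xy) λ ()
      ...   | no _ | yes refl | _ = contradiction (trans (sym yy′) (M-sym′ xy)) λ ()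
      ...   | no x′≢y | no _ | yes refl =
        contradiction (inducedPath (x≢x′ ∘ sym) x′≢y x≢y (M-sym′ xx′) (M-sym′ yy′) xy) noP
      ...   | no x′≢y | no y′≢x | no x′≢y′ with M x y′ in xy′ | M x′ y in x′y | M x′ y′ in x′y′
      ... | true | _ | _ =
        contradiction (inducedPath y′≢x (y≢y′ ∘ sym) x≢y (M-sym′ xy′) (M-sym′ yy′) xy) noP
      ... | false | true | _ =
        contradiction (inducedPath (x≢x′ ∘ sym) x′≢y x≢y (M-sym′ xx′) x′y xy) noP
      ... | false | false | true =
        contradiction (inducedPath (x≢x′ ∘ sym) x′≢y′ (y′≢x ∘ sym) (M-sym′ xx′) x′y′ xy′) noP
      ... | false | false | false =
        contradiction (inducedMatching x≢x′ x≢y (y′≢x ∘ sym) x′≢y x′≢y′ y≢y′ xx′ yy′ xy xy′ x′y x′y′)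
                      noQ

      completeOn-hasNeighbour : CompleteOn hasNeighbour M
      completeOn-hasNeighbour x y x≢y with any? (adjacent? x) | any? (adjacent? y) | M x y in xy
      ... | yes (_ , x~) | yes (_ , y~) | _ = trans (sym xy) (neighbours⇒adjacent x≢y x~ y~)
      ... | no ¬x~ | _ | true = contradiction (y , x≢y , xy) ¬x~
      ... | yes _ | no ¬y~ | true = contradiction (x , x≢y ∘ sym , M-sym′ xy) ¬y~
      ... | no _ | _ | false = refl
      ... | yes _ | no _ | false = refl

  completeOn⇔¬embeds : Symmetric M →
                       (∃ λ K → CompleteOn K M) ⇔ (¬ Embeds 3 patP M × ¬ Embeds 4 patQ M)
  completeOn⇔¬embeds M-sym = mk⇔
    (λ (K , complete) → completeOn⇒¬embedsP K complete , completeOn⇒¬embedsQ K complete)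
    (λ (noP , noQ) → hasNeighbour , completeOn-hasNeighbour M-sym noP noQ)

lemma1 : (n : ℕ) (M : Matrix n) → Symmetric M →
           (Condition1 M → Condition2 M) × (Condition2 M → Condition1 M)
lemma1 n M M-sym =
  from condition2 ∘ to clique ∘ to condition1 , from condition1 ∘ from clique ∘ to condition2
  where
  open InducedSubgraphs M
  open Equivalence
  condition1 : Condition1 M ⇔ (∃ λ K → CompleteOn K M)
  condition1 = condition1⇔completeOn
  clique : (∃ λ K → CompleteOn K M) ⇔ (¬ Embeds 3 patP M × ¬ Embeds 4 patQ M)
  clique = completeOn⇔¬embeds M-sym
  condition2 : Condition2 M ⇔ (¬ Embeds 3 patP M × ¬ Embeds 4 patQ M)
  condition2 = condition2⇔¬embeds
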